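{- Let $m\ge 1$ and $n\ge 2$, and let $G=\times_m P_n$. If $u$ is any vertex of $G$ that is not a corner vertex and $v_c$ is a corner vertex of $G$, then $l(v_c)<l(u)$.
   Context: $\times_m P_n$ is the Cartesian product of $m$ copies of the path $P_n$: its vertices are the $m$-tuples $(v_1,\dots,v_m)\in\{1,\dots,n\}^m$, and two vertices are adjacent iff they differ in exactly one coordinate, and there by exactly $1$. A corner vertex is one with all coordinates in $\{1,n\}$; a non-corner vertex has at least one coordinate in $\{2,\dots,n-1\}$. For a vertex $v$ of positive degree, with neighborhood $N_v$, the leverage centrality is $l(v)=\frac{1}{\deg(v)}\sum_{w\in N_v}\frac{\deg(v)-\deg(w)}{\deg(v)+\deg(w)}$. -}

module Defs where

open import Data.Nat as ℕ using (ℕ; zero; suc; _∸_)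
open import Data.Integer as ℤ using (ℤ)
open import Data.Rational as ℚ using (ℚ; 0ℚ; _/_)
open import Data.Fin using (Fin; toℕ)
open import Data.Fin.Properties using () renaming (_≟_ to _≟F_)
open import Data.Vec using (Vec; []; _∷_)
open import Data.Vec.Properties using () renaming (≡-dec to ≡-decVec)
open import Data.Vec.Relation.Unary.All using (All)
open import Data.List as List using (List; []; _∷_; length; filter; concatMap; map; foldr)
open import Data.Bool using (Bool; true; false; _∧_; _∨_) renaming (_≟_ to _≟B_)
open import Data.Product using (_×_)
open import Data.Sum using (_⊎_)
open import Relation.Binary.PropositionalEquality using (_≡_)
open import Relation.Nullary.Decidable using (⌊_⌋)

-- Vertices of ×_m P_n : m-tuples of elements of Fin n
-- (Fin n with values 0..n-1 stands for {1,…,n}).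
Vertex : ℕ → ℕ → Set
Vertex m n = Vec (Fin n) m

allVertices : (m n : ℕ) → List (Vertex m n)
allVertices zero    n = [] ∷ []
allVertices (suc m) n =
  concatMap (λ x → map (x ∷_) (allVertices m n)) (List.allFin n)

diff1 : ∀ {n} → Fin n → Fin n → Bool
diff1 a b = ⌊ suc (toℕ a) ℕ.≟ toℕ b ⌋ ∨ ⌊ suc (toℕ b) ℕ.≟ toℕ a ⌋

adj : ∀ {m n} → Vertex m n → Vertex m n → Bool
adj []       []       = false
adj (x ∷ xs) (y ∷ ys) =
  (⌊ x ≟F y ⌋ ∧ adj xs ys) ∨ (diff1 x y ∧ ⌊ ≡-decVec _≟F_ xs ys ⌋)

nbrs : ∀ {m n} → Vertex m n → List (Vertex m n)
nbrs {m} {n} v = filter (λ w → adj v w ≟B true) (allVertices m n)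

deg : ∀ {m n} → Vertex m n → ℕ
deg v = length (nbrs v)

-- 1/d as a rational (only ever used with d > 0 below; 1/0 := 0 by convention)
inv : ℕ → ℚ
inv zero    = 0ℚ
inv (suc d) = ℤ.+ 1 / suc d

sumℚ : List ℚ → ℚ
sumℚ = foldr ℚ._+_ 0ℚ

leverage : ∀ {m n} → Vertex m n → ℚ
leverage v =
  inv (deg v) ℚ.* sumℚ (map (λ w → (((ℤ.+ deg v) ℤ.- (ℤ.+ deg w)) / 1)
                                    ℚ.* inv (deg v ℕ.+ deg w)) (nbrs v))

IsCorner : ∀ {m n} → Vertex m n → Set
IsCorner {n = n} v = All (λ x → toℕ x ≡ 0 ⊎ toℕ x ≡ n ∸ 1) v

-- The degree of a vertex of ×_m P_n is the sum over its coordinates of their degrees in P_n, which is 1 at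
-- the two ends of the path and 2 inside. Hence a corner has degree m, every other vertex has degree > m,
-- adjacent vertices have degrees differing by at most one, and (once n ≥ 3, which a non-corner forces) every
-- neighbour of a corner has degree m + 1. So every summand (d − e)/(d + e) of l(v), d = deg v, is at least
-- −1/(2d + 1), with equality throughout at a corner: l(v_c) = −1/(2m + 1) < −1/(2 deg u + 1) ≤ l(u).
module Submission where

open import Defs
open import Data.Nat as ℕ using (ℕ; zero; suc; _+_; _*_; _∸_; _≤_; _<_; _≥_; z≤n; s≤s)
open import Data.Nat.Properties as ℕ
  using (+-identityʳ; +-suc; *-identityʳ; *-identityˡ; *-distribʳ-+; +-monoˡ-≤; +-monoʳ-≤; +-mono-≤; 1+n≢0; suc-injective)
open import Algebra.Properties.CommutativeSemigroup ℕ.+-commutativeSemigroup using (interchange)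
open import Data.Integer as ℤ using (-[1+_]; _⊖_)
open import Data.Integer.Properties as ℤ using ()
open import Data.Rational as ℚ using (ℚ; 0ℚ; 1ℚ; _/_; NonNegative; toℚᵘ)
open import Data.Rational.Properties as ℚ using ()
open import Data.Rational.Unnormalised as ℚᵘ using (mkℚᵘ)
open import Data.Rational.Unnormalised.Properties as ℚᵘ using ()
open import Algebra.Bundles using (Ring)
open import Algebra.Properties.Semiring.Mult (Ring.semiring ℚ.+-*-ring) using (×-assoc-*) renaming (_×_ to infixr 8 _·_)
open import Data.Bool using (Bool; true; false; T; _∧_; _∨_) renaming (_≟_ to _≟B_)
open import Data.Bool.Properties using (T-∧; T-∨; T-≡)
open import Data.Fin using (Fin; toℕ) renaming (zero to fzero; suc to fsuc)
open import Data.Fin.Properties using (toℕ-injective; toℕ<n) renaming (_≟_ to _≟F_)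
open import Data.Vec using ([]; _∷_; head; tail)
open import Data.Vec.Relation.Unary.All using ([]; _∷_)
open import Data.Vec.Relation.Unary.Any using (Any; here; there; satisfied)
open import Data.Vec.Properties using () renaming (≡-dec to ≡-decVec)
open import Data.List as List using (List; []; _∷_; _++_; length; filter; concatMap; map; allFin)
open import Data.List.Relation.Unary.All as All using (All; []; _∷_)
open import Data.List.Relation.Unary.All.Properties using (all-filter)
open import Data.List.Properties using (map-tabulate)
open import Data.Product using (_×_; _,_; proj₁)
open import Data.Sum using (_⊎_; inj₁; inj₂)
open import Data.Empty using (⊥-elim)
open import Function using (_∘_; _⇔_; mk⇔; Equivalence)
open import Relation.Nullary using (¬_; Dec; yes; no)
open import Relation.Nullary.Decidable using (⌊_⌋; isYes≗does; toWitness; fromWitness; _⊎-dec_)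
open import Relation.Binary.PropositionalEquality
open Equivalence using (to; from)

indicator : Bool → ℕ
indicator true  = 1
indicator false = 0

count : {A : Set} → (A → Bool) → List A → ℕ
count f []       = 0
count f (x ∷ xs) = indicator (f x) + count f xs

module _ {A : Set} where

  length-filter : (f : A → Bool) (xs : List A) →
                  length (filter (λ x → f x ≟B true) xs) ≡ count f xs
  length-filter f []       = refl
  length-filter f (x ∷ xs) with f x
  ... | true  = cong suc (length-filter f xs)
  ... | false = length-filter f xs

  count-cong : {f g : A → Bool} → (∀ x → f x ≡ g x) → ∀ xs → count f xs ≡ count g xs
  count-cong f≗g []       = refl
  count-cong f≗g (x ∷ xs) = cong₂ _+_ (cong indicator (f≗g x)) (count-cong f≗g xs)

  count-++ : (f : A → Bool) (xs ys : List A) → count f (xs ++ ys) ≡ count f xs + count f ys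
  count-++ f []       ys = refl
  count-++ f (x ∷ xs) ys = trans (cong (indicator (f x) +_) (count-++ f xs ys))
                                 (sym (ℕ.+-assoc (indicator (f x)) (count f xs) (count f ys)))

  count-none : {f : A → Bool} → (∀ x → ¬ T (f x)) → ∀ xs → count f xs ≡ 0
  count-none {f} none []       = refl
  count-none {f} none (x ∷ xs) with f x | none x
  ... | true  | fx∉ = ⊥-elim (fx∉ _)
  ... | false | _   = count-none none xs

  count-∨ : {f g : A → Bool} → (∀ x → T (f x) → ¬ T (g x)) → ∀ xs →
            count (λ x → f x ∨ g x) xs ≡ count f xs + count g xs
  count-∨ {f} {g} disjoint []       = refl
  count-∨ {f} {g} disjoint (x ∷ xs) = begin
    indicator (f x ∨ g x) + count (λ x → f x ∨ g x) xs
      ≡⟨ cong₂ _+_ (indicator-∨ (f x) (g x) (disjoint x)) (count-∨ disjoint xs) ⟩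
    (indicator (f x) + indicator (g x)) + (count f xs + count g xs)
      ≡⟨ interchange (indicator (f x)) (indicator (g x)) (count f xs) (count g xs) ⟩
    (indicator (f x) + count f xs) + (indicator (g x) + count g xs) ∎
    where
    open ≡-Reasoning
    indicator-∨ : ∀ a b → (T a → ¬ T b) → indicator (a ∨ b) ≡ indicator a + indicator b
    indicator-∨ true  true  a⇒¬b = ⊥-elim (a⇒¬b _ _)
    indicator-∨ true  false _    = refl
    indicator-∨ false b     _    = refl

  count-∧ˡ : (b : Bool) (f : A → Bool) → ∀ xs → count (λ x → b ∧ f x) xs ≡ indicator b * count f xs
  count-∧ˡ true  f xs = sym (+-identityʳ (count f xs))
  count-∧ˡ false f xs = count-none (λ _ ()) xs

count-map : {A B : Set} (f : B → Bool) (g : A → B) (xs : List A) → count f (map g xs) ≡ count (f ∘ g) xs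
count-map f g []       = refl
count-map f g (x ∷ xs) = cong (indicator (f (g x)) +_) (count-map f g xs)

count-allFin-suc : ∀ {n} (f : Fin (suc n) → Bool) →
                   count f (allFin (suc n)) ≡ indicator (f fzero) + count (f ∘ fsuc) (allFin n)
count-allFin-suc {n} f = cong (indicator (f fzero) +_) (begin
  count f (List.tabulate fsuc)        ≡⟨ cong (count f) (sym (map-tabulate (λ y → y) fsuc)) ⟩
  count f (map fsuc (allFin n))       ≡⟨ count-map f fsuc (allFin n) ⟩
  count (f ∘ fsuc) (allFin n)         ∎)
  where open ≡-Reasoning

count-allFin-toℕ≡ : ∀ {n t} (f : Fin n → Bool) → t < n → (∀ y → T (f y) ⇔ (toℕ y ≡ t)) →
             count f (allFin n) ≡ 1
count-allFin-toℕ≡ {suc n} {zero} f _ f⇔ = trans (count-allFin-suc f) (cong₂ _+_ f0 rest)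
  where
  f0 : indicator (f fzero) ≡ 1
  f0 with f fzero | from (f⇔ fzero) refl
  ... | true | _ = refl
  rest : count (f ∘ fsuc) (allFin n) ≡ 0
  rest = count-none (λ y fy → 1+n≢0 (to (f⇔ (fsuc y)) fy)) (allFin n)
count-allFin-toℕ≡ {suc n} {suc t} f (s≤s t<n) f⇔ = trans (count-allFin-suc f) (cong₂ _+_ f0 rest)
  where
  f0 : indicator (f fzero) ≡ 0
  f0 with f fzero | to (f⇔ fzero)
  ... | true  | f0⇒ = ⊥-elim (1+n≢0 (sym (f0⇒ _)))
  ... | false | _   = refl
  rest : count (f ∘ fsuc) (allFin n) ≡ 1
  rest = count-allFin-toℕ≡ (f ∘ fsuc) t<n
    (λ y → mk⇔ (suc-injective ∘ to (f⇔ (fsuc y))) (from (f⇔ (fsuc y)) ∘ cong suc))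

count-allFin-≡ : ∀ {n} (x : Fin n) → count (λ y → ⌊ x ≟F y ⌋) (allFin n) ≡ 1
count-allFin-≡ x = count-allFin-toℕ≡ (λ y → ⌊ x ≟F y ⌋) (toℕ<n x)
  (λ y → mk⇔ (λ x≡y → cong toℕ (sym (toWitness x≡y))) (λ e → fromWitness (sym (toℕ-injective e))))

count-rectangle : ∀ {m n} (g : Fin n → Bool) (h : Vertex m n → Bool) (ys : List (Fin n)) →
                  count (λ w → g (head w) ∧ h (tail w)) (concatMap (λ y → map (y ∷_) (allVertices m n)) ys)
                  ≡ count g ys * count h (allVertices m n)
count-rectangle         g h []       = refl
count-rectangle {m} {n} g h (y ∷ ys) = begin
  count gh (map (y ∷_) V ++ concatMap (λ y → map (y ∷_) V) ys)
    ≡⟨ count-++ gh (map (y ∷_) V) _ ⟩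
  count gh (map (y ∷_) V) + count gh (concatMap (λ y → map (y ∷_) V) ys)
    ≡⟨ cong₂ _+_ (trans (count-map gh (y ∷_) V) (count-∧ˡ (g y) h V)) (count-rectangle g h ys) ⟩
  indicator (g y) * count h V + count g ys * count h V
    ≡⟨ sym (*-distribʳ-+ (count h V) (indicator (g y)) (count g ys)) ⟩
  (indicator (g y) + count g ys) * count h V ∎
  where
  open ≡-Reasoning
  V = allVertices m n
  gh : Vertex (suc m) n → Bool
  gh w = g (head w) ∧ h (tail w)

count-allVertices-≡ : ∀ {m n} (xs : Vertex m n) → count (λ ys → ⌊ ≡-decVec _≟F_ xs ys ⌋) (allVertices m n) ≡ 1
count-allVertices-≡ []                      = refl
count-allVertices-≡ {suc m} {n} (x ∷ xs) = begin
  count (λ w → ⌊ ≡-decVec _≟F_ (x ∷ xs) w ⌋) (allVertices (suc m) n)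
    ≡⟨ count-cong (λ { (y ∷ ys) → ⌊≡-dec-∷⌋ y ys }) (allVertices (suc m) n) ⟩
  count (λ w → ⌊ x ≟F head w ⌋ ∧ ⌊ ≡-decVec _≟F_ xs (tail w) ⌋) (allVertices (suc m) n)
    ≡⟨ count-rectangle _ _ (allFin n) ⟩
  count (λ y → ⌊ x ≟F y ⌋) (allFin n) * count (λ ys → ⌊ ≡-decVec _≟F_ xs ys ⌋) (allVertices m n)
    ≡⟨ cong₂ _*_ (count-allFin-≡ x) (count-allVertices-≡ xs) ⟩
  1 ∎
  where
  open ≡-Reasoning
  ⌊≡-dec-∷⌋ : ∀ y ys → ⌊ ≡-decVec _≟F_ (x ∷ xs) (y ∷ ys) ⌋ ≡ ⌊ x ≟F y ⌋ ∧ ⌊ ≡-decVec _≟F_ xs ys ⌋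
  ⌊≡-dec-∷⌋ y ys = trans (isYes≗does _)
                         (sym (cong₂ _∧_ (isYes≗does (x ≟F y)) (isYes≗does (≡-decVec _≟F_ xs ys))))

pathDeg : ∀ {n} → Fin n → ℕ
pathDeg {n} x = count (diff1 x) (allFin n)

diff1⇒ : ∀ {n} (x y : Fin n) → T (diff1 x y) → suc (toℕ x) ≡ toℕ y ⊎ suc (toℕ y) ≡ toℕ x
diff1⇒ x y = ⌊⌋-∨⁻ (suc (toℕ x) ℕ.≟ toℕ y) (suc (toℕ y) ℕ.≟ toℕ x)
  where
  ⌊⌋-∨⁻ : {P Q : Set} (p? : Dec P) (q? : Dec Q) → T (⌊ p? ⌋ ∨ ⌊ q? ⌋) → P ⊎ Q
  ⌊⌋-∨⁻ (yes p) _       _ = inj₁ p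
  ⌊⌋-∨⁻ (no _)  (yes q) _ = inj₂ q

diff1-irrefl : ∀ {n} (x : Fin n) → ¬ T (diff1 x x)
diff1-irrefl x d with diff1⇒ x x d
... | inj₁ e = ℕ.1+n≢n e
... | inj₂ e = ℕ.1+n≢n e

deg-∷ : ∀ {m n} (x : Fin n) (xs : Vertex m n) → deg (x ∷ xs) ≡ pathDeg x + deg xs
deg-∷ {m} {n} x xs = begin
  deg (x ∷ xs)
    ≡⟨ length-filter (adj (x ∷ xs)) V′ ⟩
  count (adj (x ∷ xs)) V′
    ≡⟨ count-cong (λ { (y ∷ ys) → refl }) V′ ⟩
  count (λ w → same w ∨ move w) V′
    ≡⟨ count-∨ disjoint V′ ⟩
  count same V′ + count move V′
    ≡⟨ cong₂ _+_ (count-rectangle _ (adj xs) (allFin n)) (count-rectangle (diff1 x) _ (allFin n)) ⟩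
  count (λ y → ⌊ x ≟F y ⌋) (allFin n) * count (adj xs) V + pathDeg x * count (λ ys → ⌊ ≡-decVec _≟F_ xs ys ⌋) V
    ≡⟨ cong₂ _+_ (cong₂ _*_ (count-allFin-≡ x) (sym (length-filter (adj xs) V)))
                 (cong (pathDeg x *_) (count-allVertices-≡ xs)) ⟩
  1 * deg xs + pathDeg x * 1
    ≡⟨ cong₂ _+_ (*-identityˡ (deg xs)) (*-identityʳ (pathDeg x)) ⟩
  deg xs + pathDeg x
    ≡⟨ ℕ.+-comm (deg xs) (pathDeg x) ⟩
  pathDeg x + deg xs ∎
  where
  open ≡-Reasoning
  V  = allVertices m n
  V′ = allVertices (suc m) n
  same move : Vertex (suc m) n → Bool
  same w = ⌊ x ≟F head w ⌋ ∧ adj xs (tail w)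
  move w = diff1 x (head w) ∧ ⌊ ≡-decVec _≟F_ xs (tail w) ⌋
  disjoint : ∀ w → T (same w) → ¬ T (move w)
  disjoint (y ∷ ys) s mv with to (T-∧ {⌊ x ≟F y ⌋} {adj xs ys}) s
  ... | x≡y , _ with toWitness {a? = x ≟F y} x≡y
  ... | refl = diff1-irrefl x (proj₁ (to (T-∧ {diff1 x x}) mv))

IsEnd : ∀ {n} → Fin n → Set
IsEnd {n} x = toℕ x ≡ 0 ⊎ toℕ x ≡ n ∸ 1

isEnd? : ∀ {n} (x : Fin n) → Dec (IsEnd x)
isEnd? {n} x = (toℕ x ℕ.≟ 0) ⊎-dec (toℕ x ℕ.≟ n ∸ 1)

isSucc : ∀ {n} → Fin n → Fin n → Bool
isSucc x y = ⌊ suc (toℕ x) ℕ.≟ toℕ y ⌋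

rightDeg leftDeg : ∀ {n} → Fin n → ℕ
rightDeg {n} x = count (isSucc x) (allFin n)
leftDeg  {n} x = count (λ y → isSucc y x) (allFin n)

pathDeg≡rightDeg+leftDeg : ∀ {n} (x : Fin n) → pathDeg x ≡ rightDeg x + leftDeg x
pathDeg≡rightDeg+leftDeg x = count-∨ {f = isSucc x} {g = λ y → isSucc y x}
  (λ y r l → 2+n≢n (trans (cong suc (toWitness r)) (toWitness l))) (allFin _)
  where
  2+n≢n : ∀ {a} → suc (suc a) ≢ a
  2+n≢n {suc a} = 2+n≢n ∘ suc-injective

rightDeg-< : ∀ {n} (x : Fin n) → suc (toℕ x) < n → rightDeg x ≡ 1
rightDeg-< x lt = count-allFin-toℕ≡ _ lt (λ y → mk⇔ (sym ∘ toWitness) (fromWitness ∘ sym))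

rightDeg-last : ∀ {n} (x : Fin n) → toℕ x ≡ n ∸ 1 → rightDeg x ≡ 0
rightDeg-last {suc n} x e = count-none {f = isSucc x}
  (λ y r → ℕ.<-irrefl (sym (trans (cong suc (sym e)) (toWitness r))) (toℕ<n y)) (allFin _)

leftDeg-zero : ∀ {n} (x : Fin n) → toℕ x ≡ 0 → leftDeg x ≡ 0
leftDeg-zero x e = count-none {f = λ y → isSucc y x} (λ y l → 1+n≢0 (trans (toWitness l) e)) (allFin _)

leftDeg-≢0 : ∀ {n} (x : Fin n) → toℕ x ≢ 0 → leftDeg x ≡ 1
leftDeg-≢0 x x≢0 with toℕ x in eq
... | zero  = ⊥-elim (x≢0 refl)
... | suc b = count-allFin-toℕ≡ _ (ℕ.<-trans (ℕ.n<1+n b) (subst (_< _) eq (toℕ<n x)))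
  (λ y → mk⇔ (suc-injective ∘ toWitness) (fromWitness ∘ cong suc))

interior-< : ∀ {n} (x : Fin n) → ¬ IsEnd x → suc (toℕ x) < n
interior-< x ¬end = ℕ.≤∧≢⇒< (toℕ<n x) (λ e → ¬end (inj₂ (cong (_∸ 1) e)))

pathDeg-end : ∀ {n} (x : Fin n) → 2 ≤ n → IsEnd x → pathDeg x ≡ 1
pathDeg-end x n≥2 (inj₁ e) =
  trans (pathDeg≡rightDeg+leftDeg x) (cong₂ _+_ (rightDeg-< x (subst (λ t → suc t < _) (sym e) n≥2)) (leftDeg-zero x e))
pathDeg-end {suc zero} x (s≤s ()) (inj₂ _)
pathDeg-end {suc (suc k)} x _ (inj₂ e) =
  trans (pathDeg≡rightDeg+leftDeg x) (cong₂ _+_ (rightDeg-last x e) (leftDeg-≢0 x (1+n≢0 ∘ trans (sym e))))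

pathDeg-interior : ∀ {n} (x : Fin n) → ¬ IsEnd x → pathDeg x ≡ 2
pathDeg-interior x ¬end =
  trans (pathDeg≡rightDeg+leftDeg x) (cong₂ _+_ (rightDeg-< x (interior-< x ¬end)) (leftDeg-≢0 x (¬end ∘ inj₁)))

1≤pathDeg : ∀ {n} → 2 ≤ n → (x : Fin n) → 1 ≤ pathDeg x
1≤pathDeg n≥2 x with isEnd? x
... | yes end = ℕ.≤-reflexive (sym (pathDeg-end x n≥2 end))
... | no ¬end = ℕ.≤-trans (ℕ.n≤1+n 1) (ℕ.≤-reflexive (sym (pathDeg-interior x ¬end)))

pathDeg≤2 : ∀ {n} → 2 ≤ n → (x : Fin n) → pathDeg x ≤ 2
pathDeg≤2 n≥2 x with isEnd? x
... | yes end = ℕ.≤-trans (ℕ.≤-reflexive (pathDeg-end x n≥2 end)) (ℕ.n≤1+n 1)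
... | no ¬end = ℕ.≤-reflexive (pathDeg-interior x ¬end)

interior⇒3≤n : ∀ {n} (x : Fin n) → ¬ IsEnd x → 3 ≤ n
interior⇒3≤n x ¬end = ℕ.≤-trans (s≤s (s≤s (ℕ.n≢0⇒n>0 (¬end ∘ inj₁)))) (interior-< x ¬end)

end-nbr-interior : ∀ {n} → 3 ≤ n → (x y : Fin n) → IsEnd x → T (diff1 x y) → ¬ IsEnd y
end-nbr-interior {suc zero}          (s≤s ())       _ _ _ _
end-nbr-interior {suc (suc zero)}    (s≤s (s≤s ())) _ _ _ _
end-nbr-interior {suc (suc (suc k))} _ x y end d = step (toℕ<n y) end (diff1⇒ x y d)
  where
  step : ∀ {a b} → b < 3 + k → a ≡ 0 ⊎ a ≡ 2 + k → suc a ≡ b ⊎ suc b ≡ a → ¬ (b ≡ 0 ⊎ b ≡ 2 + k)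
  step _ (inj₁ refl) (inj₁ refl) = λ { (inj₁ ()) ; (inj₂ ()) }
  step _ (inj₁ refl) (inj₂ ())
  step b<3+k (inj₂ refl) (inj₁ refl) = ⊥-elim (ℕ.<-irrefl refl b<3+k)
  step _ (inj₂ refl) (inj₂ refl) = λ { (inj₁ ()) ; (inj₂ e) → ℕ.1+n≢n (sym e) }

deg-corner : ∀ {m n} → 2 ≤ n → (v : Vertex m n) → IsCorner v → deg v ≡ m
deg-corner n≥2 []       []         = refl
deg-corner n≥2 (x ∷ xs) (end ∷ es) = trans (deg-∷ x xs) (cong₂ _+_ (pathDeg-end x n≥2 end) (deg-corner n≥2 xs es))

m≤deg : ∀ {m n} → 2 ≤ n → (v : Vertex m n) → m ≤ deg v
m≤deg n≥2 []       = z≤n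
m≤deg n≥2 (x ∷ xs) = subst (_ ≤_) (sym (deg-∷ x xs)) (+-mono-≤ (1≤pathDeg n≥2 x) (m≤deg n≥2 xs))

nonCorner⇒interior : ∀ {m n} (v : Vertex m n) → ¬ IsCorner v → Any (¬_ ∘ IsEnd) v
nonCorner⇒interior []       ¬corner = ⊥-elim (¬corner [])
nonCorner⇒interior (x ∷ xs) ¬corner with isEnd? x
... | yes end = there (nonCorner⇒interior xs (¬corner ∘ (end ∷_)))
... | no ¬end = here ¬end

interior⇒m<deg : ∀ {m n} → 2 ≤ n → (v : Vertex m n) → Any (¬_ ∘ IsEnd) v → m < deg v
interior⇒m<deg n≥2 (x ∷ xs) (here ¬end) =
  subst (_ ≤_) (sym (deg-∷ x xs)) (+-mono-≤ (ℕ.≤-reflexive (sym (pathDeg-interior x ¬end))) (m≤deg n≥2 xs))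
interior⇒m<deg n≥2 (x ∷ xs) (there int) =
  subst (_ ≤_) (sym (deg-∷ x xs)) (+-mono-≤ (1≤pathDeg n≥2 x) (interior⇒m<deg n≥2 xs int))

adj-∷⁻ : ∀ {m n} (x y : Fin n) (xs ys : Vertex m n) → T (adj (x ∷ xs) (y ∷ ys)) →
         (x ≡ y × T (adj xs ys)) ⊎ (T (diff1 x y) × xs ≡ ys)
adj-∷⁻ x y xs ys a
  with to (T-∨ {⌊ x ≟F y ⌋ ∧ adj xs ys} {diff1 x y ∧ ⌊ ≡-decVec _≟F_ xs ys ⌋}) a
... | inj₁ same = let x≡y , a′ = to (T-∧ {⌊ x ≟F y ⌋}) same in inj₁ (toWitness x≡y , a′)
... | inj₂ move = let d , xs≡ys = to (T-∧ {diff1 x y}) move in inj₂ (d , toWitness xs≡ys)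

deg-nbr≤ : ∀ {m n} → 2 ≤ n → (v w : Vertex m n) → T (adj v w) → deg w ≤ suc (deg v)
deg-nbr≤ n≥2 []       []       ()
deg-nbr≤ n≥2 (x ∷ xs) (y ∷ ys) a rewrite deg-∷ x xs | deg-∷ y ys with adj-∷⁻ x y xs ys a
... | inj₁ (refl , a′) = ℕ.≤-trans (+-monoʳ-≤ (pathDeg x) (deg-nbr≤ n≥2 xs ys a′))
                                 (ℕ.≤-reflexive (+-suc (pathDeg x) (deg xs)))
... | inj₂ (_ , refl)  = +-monoˡ-≤ (deg xs) (ℕ.≤-trans (pathDeg≤2 n≥2 y) (s≤s (1≤pathDeg n≥2 x)))

deg-nbr-corner : ∀ {m n} → 3 ≤ n → (v w : Vertex m n) → IsCorner v → T (adj v w) → deg w ≡ suc (deg v)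
deg-nbr-corner n≥3 []       []       []         ()
deg-nbr-corner n≥3 (x ∷ xs) (y ∷ ys) (end ∷ es) a rewrite deg-∷ x xs | deg-∷ y ys with adj-∷⁻ x y xs ys a
... | inj₁ (refl , a′) = trans (cong (pathDeg x +_) (deg-nbr-corner n≥3 xs ys es a′)) (+-suc (pathDeg x) (deg xs))
... | inj₂ (d , refl)  = cong (_+ deg xs) (trans (pathDeg-interior y (end-nbr-interior n≥3 x y end d))
                                               (cong suc (sym (pathDeg-end x (ℕ.<⇒≤ n≥3) end))))

inv-nonNeg : ∀ k → NonNegative (inv k)
inv-nonNeg zero    = _
inv-nonNeg (suc k) = ℚ.normalize-nonNeg 1 (suc k)

toℚᵘ-·1 : ∀ k → toℚᵘ (k · 1ℚ) ℚᵘ.≃ mkℚᵘ (ℤ.+ k) 0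
toℚᵘ-·1 zero    = ℚᵘ.≃-refl
toℚᵘ-·1 (suc k) = ℚᵘ.≃-trans (ℚ.toℚᵘ-homo-+ 1ℚ (k · 1ℚ))
  (ℚᵘ.≃-trans (ℚᵘ.+-congʳ (toℚᵘ 1ℚ) (toℚᵘ-·1 k)) (ℚᵘ.*≡* cross-multiplied))
  where
  cross-multiplied : ℚᵘ.↥ (toℚᵘ 1ℚ ℚᵘ.+ mkℚᵘ (ℤ.+ k) 0) ℤ.* ℤ.+ 1
                     ≡ ℤ.+ suc k ℤ.* ℚᵘ.↧ (toℚᵘ 1ℚ ℚᵘ.+ mkℚᵘ (ℤ.+ k) 0)
  cross-multiplied rewrite ℕ.*-identityʳ k | ℤ.+◃n≡+n k | ℕ.*-identityʳ k = refl

inv-suc-*-·1 : ∀ k → inv (suc k) ℚ.* (suc k · 1ℚ) ≡ 1ℚ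
inv-suc-*-·1 k = ℚ.toℚᵘ-injective (ℚᵘ.≃-trans (ℚ.toℚᵘ-homo-* (inv (suc k)) (suc k · 1ℚ))
  (ℚᵘ.≃-trans (ℚᵘ.*-cong (ℚ.toℚᵘ-fromℚᵘ (mkℚᵘ (ℤ.+ 1) k)) (toℚᵘ-·1 (suc k)))
              (ℚᵘ.*-inverseˡ (mkℚᵘ (ℤ.+ suc k) 0))))

inv-cancel-· : ∀ k c → inv (suc k) ℚ.* (suc k · c) ≡ c
inv-cancel-· k c = begin
  inv (suc k) ℚ.* (suc k · c)              ≡⟨ cong (inv (suc k) ℚ.*_) (trans (cong (suc k ·_) (sym (ℚ.*-identityˡ c)))
                                                                            (sym (×-assoc-* (suc k) 1ℚ c))) ⟩
  inv (suc k) ℚ.* ((suc k · 1ℚ) ℚ.* c)     ≡⟨ sym (ℚ.*-assoc (inv (suc k)) (suc k · 1ℚ) c) ⟩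
  (inv (suc k) ℚ.* (suc k · 1ℚ)) ℚ.* c     ≡⟨ cong (ℚ._* c) (inv-suc-*-·1 k) ⟩
  1ℚ ℚ.* c                                 ≡⟨ ℚ.*-identityˡ c ⟩
  c                                        ∎
  where open ≡-Reasoning

inv-antitone : ∀ {a b} → a ℕ.< b → inv (suc b) ℚ.< inv (suc a)
inv-antitone {a} {b} a<b = ℚ.toℚᵘ-cancel-<
  (ℚᵘ.<-respˡ-≃ (ℚᵘ.≃-sym (ℚ.toℚᵘ-fromℚᵘ (mkℚᵘ (ℤ.+ 1) b)))
  (ℚᵘ.<-respʳ-≃ (ℚᵘ.≃-sym (ℚ.toℚᵘ-fromℚᵘ (mkℚᵘ (ℤ.+ 1) a)))
  (ℚᵘ.*<* (ℤ.+<+ (s≤s (subst₂ ℕ._<_ (sym (ℕ.+-identityʳ a)) (sym (ℕ.+-identityʳ b)) a<b))))))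

mean : {A : Set} → (A → ℚ) → List A → ℚ
mean f xs = inv (length xs) ℚ.* sumℚ (map f xs)

module _ {A : Set} {f : A → ℚ} where

  sumℚ-const : ∀ {c} (xs : List A) → All (λ x → f x ≡ c) xs → sumℚ (map f xs) ≡ length xs · c
  sumℚ-const []       []           = refl
  sumℚ-const (x ∷ xs) (fx≡c ∷ fxs) = cong₂ ℚ._+_ fx≡c (sumℚ-const xs fxs)

  sumℚ-mono : ∀ {g : A → ℚ} (xs : List A) → All (λ x → f x ℚ.≤ g x) xs →
              sumℚ (map f xs) ℚ.≤ sumℚ (map g xs)
  sumℚ-mono []       []             = ℚ.≤-refl
  sumℚ-mono (x ∷ xs) (fx≤gx ∷ fxs) = ℚ.+-mono-≤ fx≤gx (sumℚ-mono xs fxs)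

  mean-const : ∀ {c} (xs : List A) → 0 ℕ.< length xs → All (λ x → f x ≡ c) xs → mean f xs ≡ c
  mean-const {c} xs@(_ ∷ xs′) _ fxs = trans (cong (inv (length xs) ℚ.*_) (sumℚ-const xs fxs)) (inv-cancel-· (length xs′) c)

  mean-mono : ∀ {g : A → ℚ} (xs : List A) → All (λ x → f x ℚ.≤ g x) xs → mean f xs ℚ.≤ mean g xs
  mean-mono xs fxs = ℚ.*-monoˡ-≤-nonNeg (inv (length xs)) {{inv-nonNeg (length xs)}} (sumℚ-mono xs fxs)

contribution : ℕ → ℕ → ℚ
contribution d e = ((ℤ.+ d ℤ.- ℤ.+ e) / 1) ℚ.* inv (d + e)

contribution-suc : ∀ d → contribution d (suc d) ≡ ℚ.- inv (d + suc d)
contribution-suc d = begin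
  ((ℤ.+ d ℤ.- ℤ.+ suc d) / 1) ℚ.* inv (d + suc d)
    ≡⟨ cong (λ z → (z / 1) ℚ.* inv (d + suc d)) (trans (ℤ.[+m]-[+n]≡m⊖n d (suc d)) (n⊖1+n d)) ⟩
  ℚ.- 1ℚ ℚ.* inv (d + suc d)
    ≡⟨ sym (ℚ.neg-distribˡ-* 1ℚ (inv (d + suc d))) ⟩
  ℚ.- (1ℚ ℚ.* inv (d + suc d))
    ≡⟨ cong ℚ.-_ (ℚ.*-identityˡ (inv (d + suc d))) ⟩
  ℚ.- inv (d + suc d) ∎
  where
  open ≡-Reasoning
  n⊖1+n : ∀ n → n ⊖ suc n ≡ -[1+ 0 ]
  n⊖1+n zero    = refl
  n⊖1+n (suc n) = trans (ℤ.[1+m]⊖[1+n]≡m⊖n n (suc n)) (n⊖1+n n)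

contribution-nonNeg : ∀ {d e} → e ℕ.≤ d → 0ℚ ℚ.≤ contribution d e
contribution-nonNeg {d} {e} e≤d rewrite ℤ.[+m]-[+n]≡m⊖n d e | ℤ.⊖-≥ e≤d =
  ℚ.nonNegative⁻¹ _ {{ℚ.nonNeg*nonNeg⇒nonNeg (ℤ.+ (d ∸ e) / 1) {{ℚ.normalize-nonNeg (d ∸ e) 1}}
                                               (inv (d + e)) {{inv-nonNeg (d + e)}}}}

contribution-lowerBound : ∀ {d e} → e ℕ.≤ suc d → contribution d (suc d) ℚ.≤ contribution d e
contribution-lowerBound {d} {e} e≤1+d with ℕ.m≤n⇒m<n∨m≡n e≤1+d
... | inj₂ refl       = ℚ.≤-refl
... | inj₁ (s≤s e≤d)  = ℚ.≤-trans (ℚ.≤-reflexive (contribution-suc d))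
  (ℚ.≤-trans (ℚ.neg-antimono-≤ (ℚ.nonNegative⁻¹ _ {{inv-nonNeg (d + suc d)}})) (contribution-nonNeg e≤d))

contribution-suc-mono : ∀ {d d′} → d ℕ.< d′ → contribution d (suc d) ℚ.< contribution d′ (suc d′)
contribution-suc-mono {d} {d′} d<d′ rewrite contribution-suc d | contribution-suc d′ | ℕ.+-suc d d | ℕ.+-suc d′ d′ =
  ℚ.neg-antimono-< (inv-antitone (ℕ.+-mono-< d<d′ d<d′))

adjacent-nbrs : ∀ {m n} (v : Vertex m n) → All (λ w → T (adj v w)) (nbrs v)
adjacent-nbrs {m} {n} v = All.map (λ {w} → from (T-≡ {adj v w})) (all-filter (λ w → adj v w ≟B true) (allVertices m n))

-- Definitionally, leverage v = mean (λ w → contribution (deg v) (deg w)) (nbrs v), as deg v = length (nbrs v).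
leverage-lowerBound : ∀ {m n} → 2 ≤ n → (v : Vertex m n) → 0 < deg v →
                      contribution (deg v) (suc (deg v)) ℚ.≤ leverage v
leverage-lowerBound n≥2 v deg>0 = begin
  contribution (deg v) (suc (deg v))
    ≡⟨ sym (mean-const (nbrs v) deg>0 (All.universal (λ _ → refl) (nbrs v))) ⟩
  mean (λ _ → contribution (deg v) (suc (deg v))) (nbrs v)
    ≤⟨ mean-mono (nbrs v) (All.map (λ {w} a → contribution-lowerBound (deg-nbr≤ n≥2 v w a)) (adjacent-nbrs v)) ⟩
  leverage v ∎
  where open ℚ.≤-Reasoning

leverage-corner : ∀ {m n} → 3 ≤ n → 0 < m → (v : Vertex m n) → IsCorner v → leverage v ≡ contribution m (suc m)
leverage-corner {m} n≥3 m>0 v corner = trans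
  (mean-const (nbrs v) (subst (0 <_) (sym deg≡m) m>0)
    (All.map (λ {w} a → cong (contribution (deg v)) (deg-nbr-corner n≥3 v w corner a)) (adjacent-nbrs v)))
  (cong (λ d → contribution d (suc d)) deg≡m)
  where
  deg≡m : deg v ≡ m
  deg≡m = deg-corner (ℕ.<⇒≤ n≥3) v corner

mainTheorem7 : (m n : ℕ) → m ≥ 1 → n ≥ 2 → (u vc : Vertex m n) → ¬ IsCorner u → IsCorner vc →
               leverage vc ℚ.< leverage u
mainTheorem7 m n m≥1 n≥2 u vc ¬corner corner = begin-strict
  leverage vc                         ≡⟨ leverage-corner n≥3 m≥1 vc corner ⟩
  contribution m (suc m)              <⟨ contribution-suc-mono m<deg ⟩
  contribution (deg u) (suc (deg u))  ≤⟨ leverage-lowerBound n≥2 u (ℕ.≤-<-trans z≤n m<deg) ⟩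
  leverage u                          ∎
  where
  open ℚ.≤-Reasoning
  interior : Any (¬_ ∘ IsEnd) u
  interior = nonCorner⇒interior u ¬corner
  m<deg : m < deg u
  m<deg = interior⇒m<deg n≥2 u interior
  n≥3 : 3 ≤ n
  n≥3 = let _ , ¬end = satisfied interior in interior⇒3≤n _ ¬end
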